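{- The integer sequence $(a_n)_{n\ge0}$ defined by $a_n=\sum_{k=0}^{\lfloor (n-1)/2\rfloor}(-1)^k e(n-1-k,k)$ (with $a_0=0$, the empty sum) is periodic with period $12$, and its first twelve terms $a_0,\dots,a_{11}$ are $0,1,1,1,0,0,0,0,0,-1,-1,-1$.
   Context: $e(m,k)$ is the number of $k$-subsets of $\{1,\dots,m\}$ whose element sum is even (the empty set counts as even); $e(m,k)=0$ for $k>m$. -}

module Defs where

open import Data.Nat using (ℕ; zero; suc; _+_; _∸_; _/_; _%_)
open import Data.Nat.Properties using (_≟_)
open import Data.Integer as ℤ using (ℤ; +_)
open import Data.List using (List; []; _∷_; _++_; map; length; filter; upTo)
open import Data.Nat.ListAction using (sum)
open import Relation.Binary.PropositionalEquality using (_≡_)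

-- All subsets of {1,…,m}, each represented as the list of its elements
-- (every subset occurs exactly once).
subsets : ℕ → List (List ℕ)
subsets zero    = [] ∷ []
subsets (suc m) = subsets m ++ map (suc m ∷_) (subsets m)

e : ℕ → ℕ → ℕ
e m k = length (filter (λ s → length s ≟ k) (filter (λ s → sum s % 2 ≟ 0) (subsets m)))

sgn : ℕ → ℤ
sgn k with k % 2
... | zero = + 1
... | suc _ = ℤ.- (+ 1)

sumTo : ℕ → (ℕ → ℤ) → ℤ
sumTo zero    f = f 0
sumTo (suc K) f = sumTo K f ℤ.+ f (suc K)

a : ℕ → ℤ
a zero    = + 0
a (suc n) = sumTo (n / 2) (λ k → sgn k ℤ.* (+ e (n ∸ k) k))

module Submission where

-- Write C(m,k) for the binomial coefficient and
-- c(m,k) for the coefficient of x^k in  Π_{j=1}^{m} (1 + (-1)^j x).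
-- Weighting each k-subset s of {1,…,m} by (1 + (-1)^{Σ s}) counts the even
-- ones twice, so  2·e(m,k) = C(m,k) + c(m,k).  Hence
--     2·a(n+1) = B(n) + S(n),   B(n) = Σ_k (-1)^k C(n-k,k),
--                              S(n) = Σ_k (-1)^k c(n-k,k),
-- and with U(n) = Σ_k c(n-k,k) the Pascal-type recurrences of C and c give,
-- along antidiagonals,
--     B(n+2) = B(n+1) - B(n),
--     S(n+2) = S(n+1) + (-1)^n U(n),   U(n+2) = U(n+1) - (-1)^n S(n).
-- The coefficients only depend on n mod 2, so the state
-- (B, S, U at n and n+1) evolves by a map that is 2-periodic in n; a direct
-- computation shows the state returns after 12 steps, hence a is
-- 12-periodic.

open import Defs
open import Data.Nat using (ℕ)
open import Data.Integer using (ℤ; +_; -[1+_])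
open import Data.Product using (_×_)
open import Data.List using (List; []; _∷_; map; upTo)
open import Relation.Binary.PropositionalEquality using (_≡_)

open import Level using (0ℓ)
open import Data.Nat as ℕ using (zero; suc; _∸_; _/_; _%_; _≤_; _<_; _≤′_; ≤′-refl; ≤′-step)
import Data.Nat.Properties as ℕP
open import Data.Nat.DivMod using (m≡m%n+[m/n]*n; m%n<n; m/n≤m)
open import Data.Nat.ListAction using (sum)
open import Data.Integer using (_+_; _*_; -_; _-_; -1ℤ)
import Data.Integer.Properties as ℤP
open import Data.Integer.Tactic.RingSolver using (solve-∀)
open import Algebra.Properties.CommutativeSemigroup ℤP.+-commutativeSemigroup
  using (interchange)
open import Data.List using (_++_; length; filter)
open import Data.Bool using (true; false; if_then_else_)
open import Data.Product using (_,_)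
open import Relation.Nullary using (Dec; does)
open import Relation.Unary using (Pred; Decidable)
open import Relation.Binary.PropositionalEquality
  using (refl; sym; trans; cong; cong₂; module ≡-Reasoning)
open ≡-Reasoning

total : (List ℕ → ℤ) → List (List ℕ) → ℤ
total f []      = + 0
total f (s ∷ L) = f s + total f L

total-++ : ∀ f xs ys → total f (xs ++ ys) ≡ total f xs + total f ys
total-++ f []       ys = sym (ℤP.+-identityˡ (total f ys))
total-++ f (x ∷ xs) ys =
  trans (cong (_+_ (f x)) (total-++ f xs ys)) (sym (ℤP.+-assoc (f x) _ _))

total-map : ∀ f g L → total f (map g L) ≡ total (λ s → f (g s)) L
total-map f g []      = refl
total-map f g (s ∷ L) = cong (_+_ (f (g s))) (total-map f g L)

total-cong : ∀ {f g} → (∀ s → f s ≡ g s) → ∀ L → total f L ≡ total g L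
total-cong f≗g []      = refl
total-cong f≗g (s ∷ L) = cong₂ _+_ (f≗g s) (total-cong f≗g L)

total-scale : ∀ z f L → total (λ s → z * f s) L ≡ z * total f L
total-scale z f []      = sym (ℤP.*-zeroʳ z)
total-scale z f (s ∷ L) =
  trans (cong (_+_ (z * f s)) (total-scale z f L)) (sym (ℤP.*-distribˡ-+ z (f s) _))

total-+ : ∀ f g L → total (λ s → f s + g s) L ≡ total f L + total g L
total-+ f g []      = refl
total-+ f g (s ∷ L) =
  trans (cong (_+_ (f s + g s)) (total-+ f g L)) (interchange (f s) (g s) _ _)

ind : ∀ {P : Set} → Dec P → ℤ
ind d = if does d then + 1 else + 0

count-as-total : ∀ {P Q : Pred (List ℕ) 0ℓ} (P? : Decidable P) (Q? : Decidable Q) L →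
  + length (filter P? (filter Q? L)) ≡ total (λ s → ind (Q? s) * ind (P? s)) L
count-as-total P? Q? []      = refl
count-as-total P? Q? (s ∷ L) with does (Q? s)
... | false = trans (count-as-total P? Q? L) (sym (ℤP.+-identityˡ _))
... | true with does (P? s)
...   | true  = cong (_+_ (+ 1)) (count-as-total P? Q? L)
...   | false = trans (count-as-total P? Q? L) (sym (ℤP.+-identityˡ _))

sgn-suc : ∀ k → sgn (suc k) ≡ - sgn k
sgn-suc zero          = refl
sgn-suc (suc zero)    = refl
sgn-suc (suc (suc k)) = sgn-suc k

sgn-+ : ∀ m n → sgn (m ℕ.+ n) ≡ sgn m * sgn n
sgn-+ zero          n = sym (ℤP.*-identityˡ (sgn n))
sgn-+ (suc zero)    n = trans (sgn-suc n) (sym (ℤP.-1*i≡-i (sgn n)))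
sgn-+ (suc (suc m)) n = sgn-+ m n

sgn-sq : ∀ k → sgn k * sgn k ≡ + 1
sgn-sq zero          = refl
sgn-sq (suc zero)    = refl
sgn-sq (suc (suc k)) = sgn-sq k

two-ind-even : ∀ n → + 2 * ind (n % 2 ℕP.≟ 0) ≡ + 1 + sgn n
two-ind-even zero          = refl
two-ind-even (suc zero)    = refl
two-ind-even (suc (suc n)) = two-ind-even n

-- Twisted Pascal triangles and the decomposition of e

one : ℕ → ℤ
one _ = + 1

-- pascal ε m k is the coefficient of x^k in Π_{j=1}^{m} (1 + ε(j) x);
-- pascal one is the binomial coefficient, pascal sgn the signed variant c.
pascal : (ℕ → ℤ) → ℕ → ℕ → ℤ
pascal ε m       zero    = + 1
pascal ε zero    (suc k) = + 0
pascal ε (suc m) (suc k) = pascal ε m (suc k) + ε (suc m) * pascal ε m k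

pascal-vanish : ∀ ε {m k} → m < k → pascal ε m k ≡ + 0
pascal-vanish ε {zero}  {suc k} _ = refl
pascal-vanish ε {suc m} {suc k} (ℕ.s≤s m<k) = begin
  pascal ε m (suc k) + ε (suc m) * pascal ε m k
    ≡⟨ cong₂ (λ x y → x + ε (suc m) * y)
             (pascal-vanish ε (ℕP.m<n⇒m<1+n m<k)) (pascal-vanish ε m<k) ⟩
  + 0 + ε (suc m) * + 0
    ≡⟨ trans (ℤP.+-identityˡ _) (ℤP.*-zeroʳ (ε (suc m))) ⟩
  + 0 ∎

sized : ℕ → List ℕ → ℤ
sized k s = ind (length s ℕP.≟ k)

signedCount : (ℕ → ℤ) → ℕ → ℕ → ℤ
signedCount ε m k = total (λ s → sized k s * ε (sum s)) (subsets m)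

signedCount-suc : ∀ ε m k → signedCount ε (suc m) k ≡
  signedCount ε m k + total (λ s → sized k (suc m ∷ s) * ε (suc m ℕ.+ sum s)) (subsets m)
signedCount-suc ε m k =
  trans (total-++ _ (subsets m) (map (suc m ∷_) (subsets m)))
        (cong (_+_ (signedCount ε m k)) (total-map _ (suc m ∷_) (subsets m)))

-- For a multiplicative ε, the signed count of k-subsets is the twisted
-- Pascal coefficient (expand the product Π (1 + ε(j) x)).
signedCount≡pascal : ∀ ε → ε 0 ≡ + 1 → (∀ a b → ε (a ℕ.+ b) ≡ ε a * ε b) →
  ∀ m k → signedCount ε m k ≡ pascal ε m k
signedCount≡pascal ε ε0 ε+ zero zero rewrite ε0 = refl
signedCount≡pascal ε ε0 ε+ zero (suc k) = cong (_+ + 0) (ℤP.*-zeroˡ (ε 0))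
signedCount≡pascal ε ε0 ε+ (suc m) zero = begin
  signedCount ε (suc m) 0
    ≡⟨ signedCount-suc ε m 0 ⟩
  signedCount ε m 0 + total (λ s → + 0 * ε (suc m ℕ.+ sum s)) (subsets m)
    ≡⟨ cong₂ _+_ (signedCount≡pascal ε ε0 ε+ m 0) (total-scale (+ 0) (λ s → ε (suc m ℕ.+ sum s)) (subsets m)) ⟩
  + 1 + + 0 * total (λ s → ε (suc m ℕ.+ sum s)) (subsets m)
    ≡⟨ cong (_+_ (+ 1)) (ℤP.*-zeroˡ (total (λ s → ε (suc m ℕ.+ sum s)) (subsets m))) ⟩
  + 1 ∎
signedCount≡pascal ε ε0 ε+ (suc m) (suc k) = begin
  signedCount ε (suc m) (suc k)
    ≡⟨ signedCount-suc ε m (suc k) ⟩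
  signedCount ε m (suc k) + total (λ s → sized k s * ε (suc m ℕ.+ sum s)) (subsets m)
    ≡⟨ cong (_+_ (signedCount ε m (suc k))) (total-cong pull-out (subsets m)) ⟩
  signedCount ε m (suc k) + total (λ s → ε (suc m) * (sized k s * ε (sum s))) (subsets m)
    ≡⟨ cong (_+_ (signedCount ε m (suc k))) (total-scale (ε (suc m)) _ (subsets m)) ⟩
  signedCount ε m (suc k) + ε (suc m) * signedCount ε m k
    ≡⟨ cong₂ (λ x y → x + ε (suc m) * y)
             (signedCount≡pascal ε ε0 ε+ m (suc k)) (signedCount≡pascal ε ε0 ε+ m k) ⟩
  pascal ε (suc m) (suc k) ∎
  where
  pull-out : ∀ s → sized k s * ε (suc m ℕ.+ sum s) ≡ ε (suc m) * (sized k s * ε (sum s))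
  pull-out s = trans (cong (sized k s *_) (ε+ (suc m) (sum s))) (commute (sized k s) (ε (suc m)) (ε (sum s)))
    where
    commute : ∀ x y z → x * (y * z) ≡ y * (x * z)
    commute = solve-∀

-- Even subsets are counted by (1 + (-1)^{Σ s}) / 2, so 2·e(m,k) = C(m,k) + c(m,k).
two-e : ∀ m k → + 2 * + e m k ≡ pascal one m k + pascal sgn m k
two-e m k = begin
  + 2 * + e m k
    ≡⟨ cong (+ 2 *_) (count-as-total (λ s → length s ℕP.≟ k) (λ s → sum s % 2 ℕP.≟ 0) (subsets m)) ⟩
  + 2 * total (λ s → ind (sum s % 2 ℕP.≟ 0) * sized k s) (subsets m)
    ≡⟨ sym (total-scale (+ 2) _ (subsets m)) ⟩
  total (λ s → + 2 * (ind (sum s % 2 ℕP.≟ 0) * sized k s)) (subsets m)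
    ≡⟨ total-cong split (subsets m) ⟩
  total (λ s → sized k s * one (sum s) + sized k s * sgn (sum s)) (subsets m)
    ≡⟨ total-+ _ _ (subsets m) ⟩
  signedCount one m k + signedCount sgn m k
    ≡⟨ cong₂ _+_ (signedCount≡pascal one refl (λ _ _ → refl) m k)
                 (signedCount≡pascal sgn refl sgn-+ m k) ⟩
  pascal one m k + pascal sgn m k ∎
  where
  split : ∀ s → + 2 * (ind (sum s % 2 ℕP.≟ 0) * sized k s) ≡ sized k s * + 1 + sized k s * sgn (sum s)
  split s = begin
    + 2 * (ind (sum s % 2 ℕP.≟ 0) * sized k s) ≡⟨ commute _ (sized k s) ⟩
    sized k s * (+ 2 * ind (sum s % 2 ℕP.≟ 0)) ≡⟨ cong (sized k s *_) (two-ind-even (sum s)) ⟩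
    sized k s * (+ 1 + sgn (sum s))            ≡⟨ ℤP.*-distribˡ-+ (sized k s) (+ 1) _ ⟩
    sized k s * + 1 + sized k s * sgn (sum s)  ∎
    where
    commute : ∀ y x → + 2 * (y * x) ≡ x * (+ 2 * y)
    commute = solve-∀

sumTo-cong : ∀ K {f g : ℕ → ℤ} → (∀ k → f k ≡ g k) → sumTo K f ≡ sumTo K g
sumTo-cong zero    f≗g = f≗g 0
sumTo-cong (suc K) f≗g = cong₂ _+_ (sumTo-cong K f≗g) (f≗g (suc K))

sumTo-+ : ∀ K (f g : ℕ → ℤ) → sumTo K (λ k → f k + g k) ≡ sumTo K f + sumTo K g
sumTo-+ zero    f g = refl
sumTo-+ (suc K) f g =
  trans (cong (_+ (f (suc K) + g (suc K))) (sumTo-+ K f g))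
        (interchange (sumTo K f) (sumTo K g) (f (suc K)) (g (suc K)))

sumTo-scale : ∀ K z (f : ℕ → ℤ) → sumTo K (λ k → z * f k) ≡ z * sumTo K f
sumTo-scale zero    z f = refl
sumTo-scale (suc K) z f =
  trans (cong (_+ z * f (suc K)) (sumTo-scale K z f)) (sym (ℤP.*-distribˡ-+ z _ _))

sumTo-front : ∀ K (f : ℕ → ℤ) → sumTo (suc K) f ≡ f 0 + sumTo K (λ k → f (suc k))
sumTo-front zero    f = refl
sumTo-front (suc K) f =
  trans (cong (_+ f (suc (suc K))) (sumTo-front K f)) (ℤP.+-assoc (f 0) _ _)

sumTo-truncate : ∀ {K N} (f : ℕ → ℤ) → K ≤′ N → (∀ j → K < j → f j ≡ + 0) →
  sumTo N f ≡ sumTo K f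
sumTo-truncate f ≤′-refl              vanish = refl
sumTo-truncate {K} f (≤′-step {N} K≤′N) vanish = begin
  sumTo N f + f (suc N) ≡⟨ cong₂ _+_ (sumTo-truncate f K≤′N vanish)
                                     (vanish (suc N) (ℕ.s≤s (ℕP.≤′⇒≤ K≤′N))) ⟩
  sumTo K f + + 0       ≡⟨ ℤP.+-identityʳ (sumTo K f) ⟩
  sumTo K f             ∎

-- Antidiagonal sums of Pascal-type arrays

diag : (ℕ → ℕ → ℤ) → ℕ → ℕ → ℤ
diag F k zero    = F zero k
diag F k (suc n) = F (suc n) k + diag F (suc k) n

sumTo-diag : ∀ F n k → sumTo n (λ t → F (n ∸ t) (k ℕ.+ t)) ≡ diag F k n
sumTo-diag F zero    k = cong (F 0) (ℕP.+-identityʳ k)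
sumTo-diag F (suc n) k = begin
  sumTo (suc n) (λ t → F (suc n ∸ t) (k ℕ.+ t))
    ≡⟨ sumTo-front n _ ⟩
  F (suc n) (k ℕ.+ 0) + sumTo n (λ t → F (n ∸ t) (k ℕ.+ suc t))
    ≡⟨ cong₂ _+_ (cong (F (suc n)) (ℕP.+-identityʳ k))
                 (sumTo-cong n (λ t → cong (F (n ∸ t)) (ℕP.+-suc k t))) ⟩
  F (suc n) k + sumTo n (λ t → F (n ∸ t) (suc k ℕ.+ t))
    ≡⟨ cong (_+_ (F (suc n) k)) (sumTo-diag F n (suc k)) ⟩
  diag F k (suc n) ∎

past-half : ∀ n j → n / 2 < j → n ∸ j < j
past-half n j half<j = ℕP.m<n+o⇒m∸n<o n j {{nonZero}} (ℕP.<-≤-trans n<2[1+half] 2[1+half]≤j+j)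
  where
  nonZero : ℕ.NonZero j
  nonZero = ℕ.>-nonZero (ℕP.<-≤-trans (ℕ.s≤s ℕ.z≤n) half<j)
  n<2[1+half] : n < 2 ℕ.+ n / 2 ℕ.* 2
  n<2[1+half] = ℕP.<-≤-trans
    (ℕP.≤-reflexive (cong suc (m≡m%n+[m/n]*n n 2)))
    (ℕP.+-monoˡ-≤ (n / 2 ℕ.* 2) (m%n<n n 2))
  2[1+half]≤j+j : 2 ℕ.+ n / 2 ℕ.* 2 ≤ j ℕ.+ j
  2[1+half]≤j+j = ℕP.≤-trans (ℕP.*-monoˡ-≤ 2 half<j)
                             (ℕP.≤-reflexive (trans (ℕP.*-comm j 2) (cong (j ℕ.+_) (ℕP.+-identityʳ j))))

sumTo-half≡diag : ∀ F → (∀ {m k} → m < k → F m k ≡ + 0) →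
  ∀ n → sumTo (n / 2) (λ k → F (n ∸ k) k) ≡ diag F 0 n
sumTo-half≡diag F upper n = begin
  sumTo (n / 2) (λ k → F (n ∸ k) k)
    ≡⟨ sym (sumTo-truncate _ (ℕP.≤⇒≤′ (m/n≤m n 2)) (λ j half<j → upper (past-half n j half<j))) ⟩
  sumTo n (λ k → F (n ∸ k) k)
    ≡⟨ sumTo-diag F n 0 ⟩
  diag F 0 n ∎

module _ (F G : ℕ → ℕ → ℤ) (F-top : ∀ k → F 0 (suc k) ≡ + 0)
         (F-rec : ∀ m k → F (suc m) (suc k) ≡ F m (suc k) + G m k) where

  diag-rec : ∀ n k → diag F (suc k) (suc n) ≡ diag F (suc k) n + diag G k n
  diag-rec zero k = begin
    F 1 (suc k) + F 0 (suc (suc k)) ≡⟨ cong₂ _+_ (F-rec 0 k) (F-top (suc k)) ⟩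
    F 0 (suc k) + G 0 k + + 0        ≡⟨ ℤP.+-identityʳ _ ⟩
    F 0 (suc k) + G 0 k              ∎
  diag-rec (suc n) k = begin
    F (suc (suc n)) (suc k) + diag F (suc (suc k)) (suc n)
      ≡⟨ cong₂ _+_ (F-rec (suc n) k) (diag-rec n (suc k)) ⟩
    (F (suc n) (suc k) + G (suc n) k) + (diag F (suc (suc k)) n + diag G (suc k) n)
      ≡⟨ interchange (F (suc n) (suc k)) (G (suc n) k) (diag F (suc (suc k)) n) (diag G (suc k) n) ⟩
    diag F (suc k) (suc n) + diag G k (suc n) ∎

  diag-fib : (∀ m → F (suc m) 0 ≡ F m 0) →
    ∀ n → diag F 0 (suc (suc n)) ≡ diag F 0 (suc n) + diag G 0 n
  diag-fib column n = begin
    F (2 ℕ.+ n) 0 + diag F 1 (suc n)            ≡⟨ cong₂ _+_ (column (suc n)) (diag-rec n 0) ⟩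
    F (suc n) 0 + (diag F 1 n + diag G 0 n)     ≡⟨ sym (ℤP.+-assoc (F (suc n) 0) (diag F 1 n) (diag G 0 n)) ⟩
    diag F 0 (suc n) + diag G 0 n               ∎

diag-factor : ∀ (G H : ℕ → ℕ → ℤ) (h : ℕ → ℤ) → (∀ m k → G m k ≡ h (m ℕ.+ k) * H m k) →
  ∀ n k → diag G k n ≡ h (n ℕ.+ k) * diag H k n
diag-factor G H h factor zero    k = factor 0 k
diag-factor G H h factor (suc n) k = begin
  G (suc n) k + diag G (suc k) n
    ≡⟨ cong₂ _+_ (factor (suc n) k) (diag-factor G H h factor n (suc k)) ⟩
  h (suc n ℕ.+ k) * H (suc n) k + h (n ℕ.+ suc k) * diag H (suc k) n
    ≡⟨ cong (λ i → h (suc n ℕ.+ k) * H (suc n) k + h i * diag H (suc k) n) (ℕP.+-suc n k) ⟩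
  h (suc n ℕ.+ k) * H (suc n) k + h (suc n ℕ.+ k) * diag H (suc k) n
    ≡⟨ sym (ℤP.*-distribˡ-+ (h (suc n ℕ.+ k)) _ _) ⟩
  h (suc n ℕ.+ k) * diag H k (suc n) ∎

diag0-factor : ∀ (G H : ℕ → ℕ → ℤ) (h : ℕ → ℤ) → (∀ m k → G m k ≡ h (m ℕ.+ k) * H m k) →
  ∀ n → diag G 0 n ≡ h n * diag H 0 n
diag0-factor G H h factor n =
  trans (diag-factor G H h factor n 0) (cong (λ i → h i * diag H 0 n) (ℕP.+-identityʳ n))

weighted : (ℕ → ℤ) → (ℕ → ℤ) → ℕ → ℕ → ℤ
weighted w ε m k = w k * pascal ε m k

-- Inherited from pascal-vanish; this lets the sum in a run up to n instead of n / 2.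
weighted-vanish : ∀ w ε {m k} → m < k → weighted w ε m k ≡ + 0
weighted-vanish w ε {k = k} m<k = trans (cong (w k *_) (pascal-vanish ε m<k)) (ℤP.*-zeroʳ (w k))

weighted-fib : ∀ w ε n →
  diag (weighted w ε) 0 (suc (suc n)) ≡
  diag (weighted w ε) 0 (suc n) + diag (λ m k → w (suc k) * (ε (suc m) * pascal ε m k)) 0 n
weighted-fib w ε = diag-fib (weighted w ε) _
  (λ k → ℤP.*-zeroʳ (w (suc k)))
  (λ m k → ℤP.*-distribˡ-+ (w (suc k)) _ _)
  (λ m → refl)

B S U : ℕ → ℤ
B = diag (weighted sgn one) 0
S = diag (weighted sgn sgn) 0
U = diag (weighted one sgn) 0

-- The three recurrences: the new antidiagonal terms factor through B, U and S.
B-rec : ∀ n → B (suc (suc n)) ≡ B (suc n) - B n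
B-rec n = begin
  B (suc (suc n))          ≡⟨ weighted-fib sgn one n ⟩
  B (suc n) + diag _ 0 n   ≡⟨ cong (_+_ (B (suc n))) (diag0-factor _ (weighted sgn one) (λ _ → -1ℤ) factor n) ⟩
  B (suc n) + -1ℤ * B n    ≡⟨ cong (_+_ (B (suc n))) (ℤP.-1*i≡-i (B n)) ⟩
  B (suc n) - B n          ∎
  where
  factor : ∀ m k → sgn (suc k) * (+ 1 * pascal one m k) ≡ -1ℤ * weighted sgn one m k
  factor m k = trans (cong (λ x → x * (+ 1 * pascal one m k)) (sgn-suc k)) (ring (sgn k) _)
    where
    ring : ∀ x p → (- x) * (+ 1 * p) ≡ -1ℤ * (x * p)
    ring = solve-∀

S-rec : ∀ n → S (suc (suc n)) ≡ S (suc n) + sgn n * U n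
S-rec n = trans (weighted-fib sgn sgn n)
                (cong (_+_ (S (suc n))) (diag0-factor _ (weighted one sgn) sgn factor n))
  where
  factor : ∀ m k → sgn (suc k) * (sgn (suc m) * pascal sgn m k) ≡ sgn (m ℕ.+ k) * weighted one sgn m k
  factor m k rewrite sgn-suc k | sgn-suc m | sgn-+ m k = ring (sgn m) (sgn k) (pascal sgn m k)
    where
    ring : ∀ x y p → (- y) * ((- x) * p) ≡ (x * y) * (+ 1 * p)
    ring = solve-∀

U-rec : ∀ n → U (suc (suc n)) ≡ U (suc n) + sgn (suc n) * S n
U-rec n = trans (weighted-fib one sgn n)
                (cong (_+_ (U (suc n))) (diag0-factor _ (weighted sgn sgn) (λ i → sgn (suc i)) factor n))
  where
  factor : ∀ m k → + 1 * (sgn (suc m) * pascal sgn m k) ≡ sgn (suc (m ℕ.+ k)) * weighted sgn sgn m k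
  factor m k = begin
    + 1 * (sgn (suc m) * p)                ≡⟨ cong (λ x → + 1 * (x * p)) (sgn-suc m) ⟩
    + 1 * (- sgn m * p)                    ≡⟨ ring₁ (sgn m) p ⟩
    - sgn m * (+ 1 * p)                    ≡⟨ cong (λ x → - sgn m * (x * p)) (sym (sgn-sq k)) ⟩
    - sgn m * ((sgn k * sgn k) * p)        ≡⟨ ring₂ (sgn m) (sgn k) p ⟩
    - (sgn m * sgn k) * (sgn k * p)        ≡⟨ cong (λ x → - x * (sgn k * p)) (sym (sgn-+ m k)) ⟩
    - sgn (m ℕ.+ k) * (sgn k * p)          ≡⟨ cong (_* (sgn k * p)) (sym (sgn-suc (m ℕ.+ k))) ⟩
    sgn (suc (m ℕ.+ k)) * (sgn k * p)      ∎
    where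
    p = pascal sgn m k
    ring₁ : ∀ x p → + 1 * (- x * p) ≡ - x * (+ 1 * p)
    ring₁ = solve-∀
    ring₂ : ∀ x y p → - x * ((y * y) * p) ≡ - (x * y) * (y * p)
    ring₂ = solve-∀

-- The state (B, S, U at n and n+1) and its 12-periodicity

State : Set
State = ℤ × ℤ × ℤ × ℤ × ℤ × ℤ

state : ℕ → State
state n = B n , B (suc n) , S n , S (suc n) , U n , U (suc n)

-- One step of the recurrence; it depends on n only through (-1)^n.
step : ℕ → State → State
step n (b , b′ , s , s′ , u , u′) = b′ , b′ - b , s′ , s′ + sgn n * u , u′ , u′ + sgn (suc n) * s

state-step : ∀ n → state (suc n) ≡ step n (state n)
state-step n =
  cong₂ _,_ refl (cong₂ _,_ (B-rec n) (cong₂ _,_ refl (cong₂ _,_ (S-rec n)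
    (cong₂ _,_ refl (U-rec n)))))

-- After 12 steps the state returns (a finite computation), and the step map
-- at 12 + n is the one at n.
state-periodic : ∀ n → state (12 ℕ.+ n) ≡ state n
state-periodic zero    = refl
state-periodic (suc n) = begin
  state (suc (12 ℕ.+ n))           ≡⟨ state-step (12 ℕ.+ n) ⟩
  step n (state (12 ℕ.+ n))        ≡⟨ cong (step n) (state-periodic n) ⟩
  step n (state n)                 ≡⟨ sym (state-step n) ⟩
  state (suc n)                    ∎

-- 2·a(n+1) = B(n) + S(n), from 2·e = C + c termwise.
two-a : ∀ n → + 2 * a (suc n) ≡ B n + S n
two-a n = begin
  + 2 * sumTo (n / 2) (λ k → sgn k * + e (n ∸ k) k)
    ≡⟨ sym (sumTo-scale (n / 2) (+ 2) _) ⟩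
  sumTo (n / 2) (λ k → + 2 * (sgn k * + e (n ∸ k) k))
    ≡⟨ sumTo-cong (n / 2) term ⟩
  sumTo (n / 2) (λ k → weighted sgn one (n ∸ k) k + weighted sgn sgn (n ∸ k) k)
    ≡⟨ sumTo-+ (n / 2) _ _ ⟩
  sumTo (n / 2) (λ k → weighted sgn one (n ∸ k) k) + sumTo (n / 2) (λ k → weighted sgn sgn (n ∸ k) k)
    ≡⟨ cong₂ _+_ (sumTo-half≡diag _ (weighted-vanish sgn one) n)
                 (sumTo-half≡diag _ (weighted-vanish sgn sgn) n) ⟩
  B n + S n ∎
  where
  term : ∀ k → + 2 * (sgn k * + e (n ∸ k) k) ≡ weighted sgn one (n ∸ k) k + weighted sgn sgn (n ∸ k) k
  term k = begin
    + 2 * (sgn k * + e (n ∸ k) k)        ≡⟨ commute (sgn k) _ ⟩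
    sgn k * (+ 2 * + e (n ∸ k) k)        ≡⟨ cong (sgn k *_) (two-e (n ∸ k) k) ⟩
    sgn k * (pascal one (n ∸ k) k + pascal sgn (n ∸ k) k)
                                         ≡⟨ ℤP.*-distribˡ-+ (sgn k) _ _ ⟩
    weighted sgn one (n ∸ k) k + weighted sgn sgn (n ∸ k) k ∎
    where
    commute : ∀ x y → + 2 * (x * y) ≡ x * (+ 2 * y)
    commute = solve-∀

-- Cancelling the factor 2 transfers the periodicity of the state to a.
a-periodic : ∀ n → a (12 ℕ.+ n) ≡ a n
a-periodic zero    = refl
a-periodic (suc n) = ℤP.*-cancelˡ-≡ (+ 2) _ _ (begin
  + 2 * a (suc (12 ℕ.+ n))      ≡⟨ two-a (12 ℕ.+ n) ⟩
  B (12 ℕ.+ n) + S (12 ℕ.+ n)   ≡⟨ cong (λ { (b , _ , s , _) → b + s }) (state-periodic n) ⟩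
  B n + S n                     ≡⟨ sym (two-a n) ⟩
  + 2 * a (suc n)               ∎)

proposition4p4 : (∀ (n : ℕ) → a (12 Data.Nat.+ n) ≡ a n)
    × (map a (upTo 12) ≡ + 0 ∷ + 1 ∷ + 1 ∷ + 1 ∷ + 0 ∷ + 0 ∷ + 0 ∷ + 0 ∷ + 0 ∷ -[1+ 0 ] ∷ -[1+ 0 ] ∷ -[1+ 0 ] ∷ [])
proposition4p4 = a-periodic , refl
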